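{- Let $a,b,c,d$ be four distinct letters and $\mu$, $f_{n,n}$ as in the context. For $n\ge1$, $\mu(f_{n,n})=f_{n+1,n+1}$.
   Context: For arrays $u,v$ with equal numbers of rows, $u\circ_c v$ places $v$ to the right of $u$; with equal numbers of columns, $u\circ_r v$ places $v$ below $u$. Two-dimensional Fibonacci arrays: $f_{0,0}=a$, $f_{0,1}=b$, $f_{1,0}=c$, $f_{1,1}=d$, and for $k\ge0$, $m,n\ge1$: $f_{k,n+1}=f_{k,n}\circ_c f_{k,n-1}$, $f_{m+1,k}=f_{m,k}\circ_r f_{m-1,k}$. $\mu(d)=\begin{smallmatrix} d & c\\ b & a\end{smallmatrix}$, $\mu(c)=\begin{smallmatrix} d\\ b\end{smallmatrix}$ ($2\times1$), $\mu(b)=\begin{smallmatrix} d & c\end{smallmatrix}$ ($1\times2$), $\mu(a)=d$. For an array $x=[x_{i,j}]$ of size $(p,q)$ such that for each $i$ all $\mu(x_{i,j})$ have the same number of rows and for each $j$ all $\mu(x_{i,j})$ have the same number of columns, $\mu(x)=R_1\circ_r\cdots\circ_r R_p$ with $R_i=\mu(x_{i,1})\circ_c\cdots\circ_c\mu(x_{i,q})$. -}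

module Defs where

open import Data.Nat using (ℕ; zero; suc; _+_)
open import Data.Fin using (Fin)
open import Data.List as L using (List; []; _∷_)
open import Data.Vec as V using (Vec)
open import Relation.Binary.PropositionalEquality using (_≡_)
open import Data.Product using (_×_)

data Letter : Set where
  a b c d : Letter

Array : ℕ → ℕ → Set
Array p q = Vec (Vec Letter q) p

_∘c_ : ∀ {p q r} → Array p q → Array p r → Array p (q + r)
u ∘c v = V.zipWith V._++_ u v

_∘r_ : ∀ {p q r} → Array p r → Array q r → Array (p + q) r
u ∘r v = u V.++ v

F : ℕ → ℕ
F zero = 1
F (suc zero) = 1
F (suc (suc n)) = F (suc n) + F n

-- the rows k = 0 and k = 1: f_{k,n+1} = f_{k,n} ∘c f_{k,n-1}
f0 : (n : ℕ) → Array 1 (F n)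
f0 zero = (a V.∷ V.[]) V.∷ V.[]
f0 (suc zero) = (b V.∷ V.[]) V.∷ V.[]
f0 (suc (suc n)) = f0 (suc n) ∘c f0 n

f1 : (n : ℕ) → Array 1 (F n)
f1 zero = (c V.∷ V.[]) V.∷ V.[]
f1 (suc zero) = (d V.∷ V.[]) V.∷ V.[]
f1 (suc (suc n)) = f1 (suc n) ∘c f1 n

fib2 : (m n : ℕ) → Array (F m) (F n)
fib2 zero n = f0 n
fib2 (suc zero) n = f1 n
fib2 (suc (suc m)) n = fib2 (suc m) n ∘r fib2 m n

-- arrays as lists of rows (used for μ, whose output size is computed)
toLists : ∀ {p q} → Array p q → List (List Letter)
toLists x = L.map V.toList (V.toList x)

μL : Letter → List (List Letter)
μL d = (d ∷ c ∷ []) ∷ (b ∷ a ∷ []) ∷ []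
μL c = (d ∷ []) ∷ (b ∷ []) ∷ []
μL b = (d ∷ c ∷ []) ∷ []
μL a = (d ∷ []) ∷ []

rowsμ : Letter → ℕ
rowsμ d = 2
rowsμ c = 2
rowsμ b = 1
rowsμ a = 1

colsμ : Letter → ℕ
colsμ d = 2
colsμ c = 1
colsμ b = 2
colsμ a = 1

-- horizontal concatenation of a nonempty list of blocks (lists of rows)
hcat : List (List (List Letter)) → List (List Letter)
hcat [] = []
hcat (u ∷ []) = u
hcat (u ∷ us@(_ ∷ _)) = L.zipWith L._++_ u (hcat us)

μ : ∀ {p q} → Array p q → List (List Letter)
μ x = L.concat (L.map (λ row → hcat (L.map μL (V.toList row))) (V.toList x))

μ-defined : ∀ {p q} → Array p q → Set
μ-defined {p} {q} x =
  (∀ (i : Fin p) (j j′ : Fin q) →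
     rowsμ (V.lookup (V.lookup x i) j) ≡ rowsμ (V.lookup (V.lookup x i) j′))
  × (∀ (i i′ : Fin p) (j : Fin q) →
     colsμ (V.lookup (V.lookup x i) j) ≡ colsμ (V.lookup (V.lookup x i′) j))

{-# OPTIONS --safe #-}
-- Let φ be the Fibonacci morphism 0 ↦ 1, 1 ↦ 10 on Bool (false = 0, true = 1). Then
-- the letter of f_{m,n} at (i, j) is determined by the i-th letter of the m-th word and
-- the j-th letter of the n-th, so f_{m,n} is the "tensor product" of two Fibonacci words.
-- μ is the tensor square of φ, hence μ(u ⊗ v) = φ(u) ⊗ φ(v), and
-- φ maps the n-th Fibonacci word to the (n+1)-st.
module Submission where

open import Defs
open import Data.Bool using (Bool; true; false)
open import Data.List as L using (List; []; _∷_; _++_; concatMap)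
import Data.List.Properties as LP
open import Data.Nat using (ℕ; suc; _≥_)
open import Data.Product using (_×_; _,_)
open import Data.Vec as V using (Vec)
import Data.Vec.Properties as VP
open import Function using (_∘_)
open import Relation.Binary.PropositionalEquality
  using (_≡_; _≢_; refl; sym; trans; cong; cong₂; module ≡-Reasoning)

letter : Bool → Bool → Letter
letter false false = a
letter false true  = b
letter true  false = c
letter true  true  = d

φ : Bool → List Bool
φ true  = true ∷ false ∷ []
φ false = true ∷ []

fibWord : (n : ℕ) → Vec Bool (F n)
fibWord 0 = false V.∷ V.[]
fibWord 1 = true V.∷ V.[]
fibWord (suc (suc n)) = fibWord (suc n) V.++ fibWord n

fibWord-suc : ∀ n → V.toList (fibWord (suc n)) ≡ concatMap φ (V.toList (fibWord n))
fibWord-suc 0 = refl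
fibWord-suc 1 = refl
fibWord-suc (suc (suc n)) = begin
    V.toList (fibWord (suc (suc n)) V.++ fibWord (suc n))
  ≡⟨ VP.toList-++ (fibWord (suc (suc n))) (fibWord (suc n)) ⟩
    V.toList (fibWord (suc (suc n))) ++ V.toList (fibWord (suc n))
  ≡⟨ cong₂ _++_ (fibWord-suc (suc n)) (fibWord-suc n) ⟩
    concatMap φ (V.toList (fibWord (suc n))) ++ concatMap φ (V.toList (fibWord n))
  ≡⟨ sym (LP.concatMap-++ φ (V.toList (fibWord (suc n))) (V.toList (fibWord n))) ⟩
    concatMap φ (V.toList (fibWord (suc n)) ++ V.toList (fibWord n))
  ≡⟨ cong (concatMap φ) (sym (VP.toList-++ (fibWord (suc n)) (fibWord n))) ⟩
    concatMap φ (V.toList (fibWord (suc (suc n))))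
  ∎
  where open ≡-Reasoning

fibWord-nonempty : ∀ n → V.toList (fibWord n) ≢ []
fibWord-nonempty 0 ()
fibWord-nonempty 1 ()
fibWord-nonempty (suc (suc n)) eq = fibWord-nonempty (suc n)
  (LP.++-conicalˡ _ (V.toList (fibWord n)) (trans (sym (VP.toList-++ (fibWord (suc n)) (fibWord n))) eq))

infix 7 _⊗_ _⊗ᴸ_

_⊗_ : ∀ {p q} → Vec Bool p → Vec Bool q → Array p q
w ⊗ v = V.map (λ x → V.map (letter x) v) w

_⊗ᴸ_ : List Bool → List Bool → List (List Letter)
w ⊗ᴸ v = L.map (λ x → L.map (letter x) v) w

⊗-++ˡ : ∀ {p p′ q} (w : Vec Bool p) (w′ : Vec Bool p′) (v : Vec Bool q) →
  (w V.++ w′) ⊗ v ≡ (w ⊗ v) ∘r (w′ ⊗ v)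
⊗-++ˡ w w′ v = VP.map-++ (λ x → V.map (letter x) v) w w′

⊗-++ʳ : ∀ {p q q′} (w : Vec Bool p) (v : Vec Bool q) (v′ : Vec Bool q′) →
  w ⊗ (v V.++ v′) ≡ (w ⊗ v) ∘c (w ⊗ v′)
⊗-++ʳ V.[] v v′ = refl
⊗-++ʳ (x V.∷ w) v v′ = cong₂ V._∷_ (VP.map-++ (letter x) v v′) (⊗-++ʳ w v v′)

f0≡⊗ : ∀ n → f0 n ≡ (false V.∷ V.[]) ⊗ fibWord n
f0≡⊗ 0 = refl
f0≡⊗ 1 = refl
f0≡⊗ (suc (suc n)) =
  trans (cong₂ _∘c_ (f0≡⊗ (suc n)) (f0≡⊗ n)) (sym (⊗-++ʳ _ (fibWord (suc n)) (fibWord n)))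

f1≡⊗ : ∀ n → f1 n ≡ (true V.∷ V.[]) ⊗ fibWord n
f1≡⊗ 0 = refl
f1≡⊗ 1 = refl
f1≡⊗ (suc (suc n)) =
  trans (cong₂ _∘c_ (f1≡⊗ (suc n)) (f1≡⊗ n)) (sym (⊗-++ʳ _ (fibWord (suc n)) (fibWord n)))

fib2≡⊗ : ∀ m n → fib2 m n ≡ fibWord m ⊗ fibWord n
fib2≡⊗ 0 n = f0≡⊗ n
fib2≡⊗ 1 n = f1≡⊗ n
fib2≡⊗ (suc (suc m)) n =
  trans (cong₂ _∘r_ (fib2≡⊗ (suc m) n) (fib2≡⊗ m n)) (sym (⊗-++ˡ (fibWord (suc m)) (fibWord m) (fibWord n)))

lookup-⊗ : ∀ {p q} (w : Vec Bool p) (v : Vec Bool q) i j →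
  V.lookup (V.lookup (w ⊗ v) i) j ≡ letter (V.lookup w i) (V.lookup v j)
lookup-⊗ w v i j = trans (cong (λ row → V.lookup row j) (VP.lookup-map i _ w))
                         (VP.lookup-map j (letter (V.lookup w i)) v)

rowsμ-letter : ∀ x y → rowsμ (letter x y) ≡ L.length (φ x)
rowsμ-letter false false = refl
rowsμ-letter false true  = refl
rowsμ-letter true  false = refl
rowsμ-letter true  true  = refl

colsμ-letter : ∀ x y → colsμ (letter x y) ≡ L.length (φ y)
colsμ-letter false false = refl
colsμ-letter false true  = refl
colsμ-letter true  false = refl
colsμ-letter true  true  = refl

μ-defined-⊗ : ∀ {p q} (w : Vec Bool p) (v : Vec Bool q) → μ-defined (w ⊗ v)
μ-defined-⊗ w v =
  (λ i j j′ → trans (rowsμ-⊗ i j) (sym (rowsμ-⊗ i j′))) ,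
  (λ i i′ j → trans (colsμ-⊗ i j) (sym (colsμ-⊗ i′ j)))
  where
  rowsμ-⊗ : ∀ i j → rowsμ (V.lookup (V.lookup (w ⊗ v) i) j) ≡ L.length (φ (V.lookup w i))
  rowsμ-⊗ i j = trans (cong rowsμ (lookup-⊗ w v i j)) (rowsμ-letter _ _)

  colsμ-⊗ : ∀ i j → colsμ (V.lookup (V.lookup (w ⊗ v) i) j) ≡ L.length (φ (V.lookup v j))
  colsμ-⊗ i j = trans (cong colsμ (lookup-⊗ w v i j)) (colsμ-letter _ _)

toLists-⊗ : ∀ {p q} (w : Vec Bool p) (v : Vec Bool q) →
  toLists (w ⊗ v) ≡ V.toList w ⊗ᴸ V.toList v
toLists-⊗ V.[] v = refl
toLists-⊗ (x V.∷ w) v = cong₂ _∷_ (VP.toList-map (letter x) v) (toLists-⊗ w v)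

μᴸ : List (List Letter) → List (List Letter)
μᴸ = concatMap (hcat ∘ L.map μL)

μ≡μᴸ∘toLists : ∀ {p q} (x : Array p q) → μ x ≡ μᴸ (toLists x)
μ≡μᴸ∘toLists x = cong L.concat (LP.map-∘ {g = hcat ∘ L.map μL} {f = V.toList} (V.toList x))

μL-letter : ∀ x y → μL (letter x y) ≡ φ x ⊗ᴸ φ y
μL-letter false false = refl
μL-letter false true  = refl
μL-letter true  false = refl
μL-letter true  true  = refl

zipWith-++-⊗ᴸ : ∀ w v v′ → L.zipWith _++_ (w ⊗ᴸ v) (w ⊗ᴸ v′) ≡ w ⊗ᴸ (v ++ v′)
zipWith-++-⊗ᴸ [] v v′ = refl
zipWith-++-⊗ᴸ (x ∷ w) v v′ =
  cong₂ _∷_ (sym (LP.map-++ (letter x) v v′)) (zipWith-++-⊗ᴸ w v v′)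

-- hcat [] is [] rather than a column of |φ x| empty rows, so v must be nonempty.
hcat-μL-row : ∀ x v → v ≢ [] →
  hcat (L.map μL (L.map (letter x) v)) ≡ φ x ⊗ᴸ concatMap φ v
hcat-μL-row x [] v≢[] with () ← v≢[] refl
hcat-μL-row x (y ∷ []) _ =
  trans (μL-letter x y) (cong (φ x ⊗ᴸ_) (sym (LP.++-identityʳ (φ y))))
hcat-μL-row x (y ∷ vs@(_ ∷ _)) _ = begin
    L.zipWith _++_ (μL (letter x y)) (hcat (L.map μL (L.map (letter x) vs)))
  ≡⟨ cong₂ (L.zipWith _++_) (μL-letter x y) (hcat-μL-row x vs λ ()) ⟩
    L.zipWith _++_ (φ x ⊗ᴸ φ y) (φ x ⊗ᴸ concatMap φ vs)
  ≡⟨ zipWith-++-⊗ᴸ (φ x) (φ y) (concatMap φ vs) ⟩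
    φ x ⊗ᴸ concatMap φ (y ∷ vs)
  ∎
  where open ≡-Reasoning

μᴸ-⊗ᴸ : ∀ w v → v ≢ [] → μᴸ (w ⊗ᴸ v) ≡ concatMap φ w ⊗ᴸ concatMap φ v
μᴸ-⊗ᴸ [] v _ = refl
μᴸ-⊗ᴸ (x ∷ w) v v≢[] = begin
    hcat (L.map μL (L.map (letter x) v)) ++ μᴸ (w ⊗ᴸ v)
  ≡⟨ cong₂ _++_ (hcat-μL-row x v v≢[]) (μᴸ-⊗ᴸ w v v≢[]) ⟩
    φ x ⊗ᴸ concatMap φ v ++ concatMap φ w ⊗ᴸ concatMap φ v
  ≡⟨ sym (LP.map-++ (λ y → L.map (letter y) (concatMap φ v)) (φ x) (concatMap φ w)) ⟩
    concatMap φ (x ∷ w) ⊗ᴸ concatMap φ v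
  ∎
  where open ≡-Reasoning

μ-fibWord-⊗ : ∀ m n →
  μ (fibWord m ⊗ fibWord n) ≡ toLists (fibWord (suc m) ⊗ fibWord (suc n))
μ-fibWord-⊗ m n = begin
    μ (fibWord m ⊗ fibWord n)
  ≡⟨ μ≡μᴸ∘toLists (fibWord m ⊗ fibWord n) ⟩
    μᴸ (toLists (fibWord m ⊗ fibWord n))
  ≡⟨ cong μᴸ (toLists-⊗ (fibWord m) (fibWord n)) ⟩
    μᴸ (V.toList (fibWord m) ⊗ᴸ V.toList (fibWord n))
  ≡⟨ μᴸ-⊗ᴸ (V.toList (fibWord m)) (V.toList (fibWord n)) (fibWord-nonempty n) ⟩
    concatMap φ (V.toList (fibWord m)) ⊗ᴸ concatMap φ (V.toList (fibWord n))
  ≡⟨ sym (cong₂ _⊗ᴸ_ (fibWord-suc m) (fibWord-suc n)) ⟩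
    V.toList (fibWord (suc m)) ⊗ᴸ V.toList (fibWord (suc n))
  ≡⟨ sym (toLists-⊗ (fibWord (suc m)) (fibWord (suc n))) ⟩
    toLists (fibWord (suc m) ⊗ fibWord (suc n))
  ∎
  where open ≡-Reasoning

corollary2 : (n : ℕ) → n ≥ 1 →
    μ-defined (fib2 n n) × μ (fib2 n n) ≡ toLists (fib2 (suc n) (suc n))
corollary2 n _ rewrite fib2≡⊗ n n | fib2≡⊗ (suc n) (suc n) =
  μ-defined-⊗ (fibWord n) (fibWord n) , μ-fibWord-⊗ n n
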